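{- Let $\mathbb{K}$ be a finite field of characteristic different from $2$, $x\in\mathbb{K}^*$, and let $m$ be the size of the $(x,\mathbb{K})$-monomial minimal solution of $(E_{\mathbb{K}})$. Then the $x$-polarized minimal solution of $(E_{\mathbb{K}})$ is reducible and has size $2m$.
   Context: For a commutative unital ring $A$ and $a_1,\ldots,a_n\in A$ set $M_n(a_1,\ldots,a_n)=\begin{pmatrix} a_n & -1_A\\ 1_A & 0_A\end{pmatrix}\cdots\begin{pmatrix} a_1 & -1_A\\ 1_A & 0_A\end{pmatrix}$. An $n$-tuple is a solution of $(E_A)$ if $M_n(a_1,\ldots,a_n)=\pm \mathrm{Id}$. For tuples, $(a_1,\ldots,a_n)\oplus(b_1,\ldots,b_m)=(a_1+b_m,a_2,\ldots,a_{n-1},a_n+b_1,b_2,\ldots,b_{m-1})$. Write $(a_1,\ldots,a_n)\sim(b_1,\ldots,b_n)$ if $(b_1,\ldots,b_n)$ is obtained from $(a_1,\ldots,a_n)$ or from $(a_n,\ldots,a_1)$ by a cyclic permutation. A solution $(c_1,\ldots,c_n)$ with $n\geq 3$ is reducible if there exist a solution $(b_1,\ldots,b_l)$ and a tuple $(a_1,\ldots,a_m)$ with $l,m\geq 3$ and $(c_1,\ldots,c_n)\sim(a_1,\ldots,a_m)\oplus(b_1,\ldots,b_l)$; otherwise irreducible. The $(x,\mathbb{K})$-monomial minimal solution is the solution all of whose components equal $x$, of minimal size. An $x$-polarized solution is a solution of size $2l$ ($l\geq 1$) of the form $(x,\ldots,x,-x,\ldots,-x)$ with $l$ entries $x$ followed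 by $l$ entries $-x$; the $x$-polarized minimal solution is the one with $l$ smallest. -}

module Defs where

open import Level using (Level; _⊔_; suc)
open import Algebra.Bundles using (CommutativeRing)
open import Data.Nat using (ℕ; _≤_; _<_)
open import Data.List using (List; []; _∷_; _++_; length; replicate; reverse; drop; take)
open import Data.List.Relation.Unary.Any using (Any)
open import Data.List.Relation.Binary.Pointwise using (Pointwise)
open import Data.Product using (Σ; ∃; _×_; _,_)
open import Data.Sum using (_⊎_)
open import Relation.Nullary using (¬_)
open import Relation.Binary using (Decidable)

record FiniteField c ℓ : Set (Level.suc (c ⊔ ℓ)) where
  field
    commRing : CommutativeRing c ℓ
  open CommutativeRing commRing public
  field
    1≉0      : ¬ (1# ≈ 0#)
    inverse  : ∀ x → ¬ (x ≈ 0#) → ∃ λ y → (x * y) ≈ 1#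
    _≟_      : Decidable _≈_
    elements : List Carrier
    complete : ∀ x → Any (x ≈_) elements

module _ {c ℓ} (K : FiniteField c ℓ) where
  open FiniteField K

  CharNot2 : Set ℓ
  CharNot2 = ¬ ((1# + 1#) ≈ 0#)

  record Mat : Set c where
    constructor mat
    field
      m11 m12 m21 m22 : Carrier

  _·_ : Mat → Mat → Mat
  mat a b c' d · mat e f g h =
    mat (a * e + b * g) (a * f + b * h) (c' * e + d * g) (c' * f + d * h)

  _≈M_ : Mat → Mat → Set ℓ
  mat a b c' d ≈M mat e f g h = (a ≈ e) × (b ≈ f) × (c' ≈ g) × (d ≈ h)

  Id : Mat
  Id = mat 1# 0# 0# 1#

  -Id : Mat
  -Id = mat (- 1#) 0# 0# (- 1#)

  elemM : Carrier → Mat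
  elemM a = mat a (- 1#) 1# 0#

  -- M_n(a_1,…,a_n) = elemM a_n · … · elemM a_1
  M : List Carrier → Mat
  M []       = Id
  M (a ∷ as) = M as · elemM a

  IsSolution : List Carrier → Set ℓ
  IsSolution as = (1 ≤ length as) × (M as ≈M Id ⊎ M as ≈M -Id)

  dropLast : List Carrier → List Carrier
  dropLast []           = []
  dropLast (_ ∷ [])     = []
  dropLast (a ∷ b ∷ as) = a ∷ dropLast (b ∷ as)

  lastOf : Carrier → List Carrier → Carrier
  lastOf d []       = d
  lastOf _ (a ∷ as) = lastOf a as

  -- (a_1,…,a_n) ⊕ (b_1,…,b_m) = (a_1+b_m, a_2,…,a_{n-1}, a_n+b_1, b_2,…,b_{m-1})
  -- (only used for n, m ≥ 3; the [] cases are irrelevant junk)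
  _⊕_ : List Carrier → List Carrier → List Carrier
  []       ⊕ bs       = bs
  (a ∷ as) ⊕ []       = a ∷ as
  (a ∷ as) ⊕ (b ∷ bs) =
    (a + lastOf b bs) ∷ (dropLast as ++ ((lastOf a as + b) ∷ dropLast bs))

  _≋_ : List Carrier → List Carrier → Set (c ⊔ ℓ)
  _≋_ = Pointwise _≈_

  rotate : ℕ → List Carrier → List Carrier
  rotate k as = drop k as ++ take k as

  _∼_ : List Carrier → List Carrier → Set (c ⊔ ℓ)
  as ∼ bs = ∃ λ k → (k ≤ length as) ×
              (bs ≋ rotate k as ⊎ bs ≋ rotate k (reverse as))

  Reducible : List Carrier → Set (c ⊔ ℓ)
  Reducible cs = (3 ≤ length cs) ×
    ∃ λ (as : List Carrier) → ∃ λ (bs : List Carrier) →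
      (3 ≤ length as) × (3 ≤ length bs) × IsSolution bs × (cs ∼ (as ⊕ bs))

  monomial : ℕ → Carrier → List Carrier
  monomial n x = replicate n x

  polarized : ℕ → Carrier → List Carrier
  polarized l x = replicate l x ++ replicate l (- x)

  IsMonomialMinimalSize : Carrier → ℕ → Set ℓ
  IsMonomialMinimalSize x m =
    IsSolution (monomial m x) × (∀ n → 1 ≤ n → n < m → ¬ IsSolution (monomial n x))

  IsPolarizedMinimalHalf : Carrier → ℕ → Set ℓ
  IsPolarizedMinimalHalf x l =
    1 ≤ l × IsSolution (polarized l x) × (∀ k → 1 ≤ k → k < l → ¬ IsSolution (polarized k x))

{-# OPTIONS --safe #-}
module Submission where

-- Write E(y) for the matrix (y −1 ; 1 0). By Cayley–Hamilton, E(y)ᵏ = d·Id + c·E(y) for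
-- scalars c = c_y(k), d = d_y(k), and det E(y)ᵏ = 1; so E(y)ᵏ = ±Id iff c_y(k) = 0, since
-- then d² = 1. As E(−y) = −D·E(y)·D with D = diag(1, −1), the coefficients for −y are
-- c_{−y}(k) = ∓c_y(k) and d_{−y}(k) = ±d_y(k), and the off-diagonal entry of the polarized
-- product E(−x)ᵏ·E(x)ᵏ is ∓x·c_x(k)². In a field it vanishes iff c_x(k) = 0, so the
-- polarized tuple of size 2k is a solution iff the monomial tuple of size k is. Finally
-- c_x(1) = 1 and c_x(2) = x force m ≥ 3, which leaves room for the decomposition
-- (x, …, x, −x, …, −x) ∼ (0, −x, …, −x, 0) ⊕ (x, …, x).

open import Defs
open import Data.Nat using (ℕ)
open import Data.Product using (_×_)
open import Relation.Nullary using (¬_)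

open import Algebra.Bundles using (RawRing; CommutativeRing)
open import Algebra.Solver.Ring.AlmostCommutativeRing
  using (fromCommutativeRing; _-Raw-AlmostCommutative⟶_)
open import Data.Empty using (⊥-elim)
open import Data.List using (List; []; _∷_; _++_; _∷ʳ_; replicate; drop; take; length)
open import Data.List.Properties using (length-replicate; length-++-≤ˡ)
import Data.List.Relation.Binary.Pointwise as Pointwise
open import Data.List.Relation.Binary.Pointwise using (_∷_)
open import Data.Maybe using (Maybe; just; nothing)
open import Data.Nat as ℕ using (zero; suc; _≤_; _<_; s≤s; z≤n)
import Data.Nat.Properties as ℕ
open import Data.Product using (_,_; proj₁; proj₂)
open import Data.Sum as Sum using (_⊎_; inj₁; inj₂)
open import Function.Base using (_∘_)
open import Function.Bundles using (_⇔_; mk⇔; module Equivalence)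
open Equivalence using (to; from)
open import Level using (0ℓ)
open import Relation.Binary.PropositionalEquality as ≡ using (_≡_)
open import Relation.Nullary using (yes; no)

-- Algebra.Solver.Ring for an arbitrary commutative ring R, with integer coefficients
-- represented as pairs (a , b) of naturals standing for a − b.
module DifferenceCoefficientSolver {ℓ₁ ℓ₂} (R : CommutativeRing ℓ₁ ℓ₂) where
  open CommutativeRing R
  open import Algebra.Properties.Ring ring
    using (-0#≈0#; -‿+-comm; ⁻¹-anti-homo‿-; x[y-z]≈xy-xz; [y-z]x≈yx-zx)
  open import Algebra.Properties.CommutativeSemigroup +-commutativeSemigroup
    using (interchange)
  open import Algebra.Properties.Semiring.Mult.TCOptimised semiring
    using (×-homo-+; ×1-homo-*) renaming (_×_ to _×′_)
  open import Relation.Binary.Reasoning.Setoid setoid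

  differences : RawRing 0ℓ 0ℓ
  differences = record
    { Carrier = ℕ × ℕ
    ; _≈_     = _≡_
    ; _+_     = λ (a , b) (c , d) → (a ℕ.+ c , b ℕ.+ d)
    ; _*_     = λ (a , b) (c , d) → (a ℕ.* c ℕ.+ b ℕ.* d , a ℕ.* d ℕ.+ b ℕ.* c)
    ; -_      = λ (a , b) → (b , a)
    ; 0#      = (0 , 0)
    ; 1#      = (1 , 0)
    }

  embed : ℕ → Carrier
  embed n = n ×′ 1#

  infix 7 _⊖_
  _⊖_ : ℕ → ℕ → Carrier
  a ⊖ b = embed a - embed b

  -- Defined by cases rather than as a ⊖ b so that the constants (0 , 0) and (1 , 0)
  -- denote 0# and 1# on the nose.
  ⟦_⟧ᶜ : ℕ × ℕ → Carrier
  ⟦ a     , zero  ⟧ᶜ = embed a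
  ⟦ zero  , suc b ⟧ᶜ = - embed (suc b)
  ⟦ suc a , suc b ⟧ᶜ = ⟦ a , b ⟧ᶜ

  sum-difference : ∀ p q r s → (p + q) - (r + s) ≈ (p - r) + (q - s)
  sum-difference p q r s = begin
    (p + q) - (r + s)     ≈⟨ +-congˡ (-‿+-comm r s) ⟨
    (p + q) + (- r + - s) ≈⟨ interchange p q (- r) (- s) ⟩
    (p - r) + (q - s)     ∎

  product-difference : ∀ p q r s → (p * r + q * s) - (p * s + q * r) ≈ (p - q) * (r - s)
  product-difference p q r s = begin
    (p * r + q * s) - (p * s + q * r) ≈⟨ +-congˡ (-‿cong (+-comm (p * s) (q * r))) ⟩
    (p * r + q * s) - (q * r + p * s) ≈⟨ sum-difference (p * r) (q * s) (q * r) (p * s) ⟩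
    (p * r - q * r) + (q * s - p * s) ≈⟨ +-congˡ (⁻¹-anti-homo‿- (p * s) (q * s)) ⟨
    (p * r - q * r) - (p * s - q * s) ≈⟨ +-cong ([y-z]x≈yx-zx r p q)
                                                 (-‿cong ([y-z]x≈yx-zx s p q)) ⟨
    (p - q) * r - (p - q) * s         ≈⟨ x[y-z]≈xy-xz (p - q) r s ⟨
    (p - q) * (r - s)                 ∎

  ⊖-+ : ∀ a b c d → (a ℕ.+ c) ⊖ (b ℕ.+ d) ≈ a ⊖ b + c ⊖ d
  ⊖-+ a b c d = trans (+-cong (×-homo-+ 1# a c) (-‿cong (×-homo-+ 1# b d)))
                      (sum-difference (embed a) (embed c) (embed b) (embed d))

  ⊖-* : ∀ a b c d → (a ℕ.* c ℕ.+ b ℕ.* d) ⊖ (a ℕ.* d ℕ.+ b ℕ.* c) ≈ (a ⊖ b) * (c ⊖ d)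
  ⊖-* a b c d = begin
    (a ℕ.* c ℕ.+ b ℕ.* d) ⊖ (a ℕ.* d ℕ.+ b ℕ.* c)
      ≈⟨ +-cong (×-homo-+ 1# (a ℕ.* c) (b ℕ.* d)) (-‿cong (×-homo-+ 1# (a ℕ.* d) (b ℕ.* c))) ⟩
    (embed (a ℕ.* c) + embed (b ℕ.* d)) - (embed (a ℕ.* d) + embed (b ℕ.* c))
      ≈⟨ +-cong (+-cong (×1-homo-* a c) (×1-homo-* b d))
                (-‿cong (+-cong (×1-homo-* a d) (×1-homo-* b c))) ⟩
    (embed a * embed c + embed b * embed d) - (embed a * embed d + embed b * embed c)
      ≈⟨ product-difference (embed a) (embed b) (embed c) (embed d) ⟩
    (a ⊖ b) * (c ⊖ d) ∎

  ⊖-shift : ∀ k a b → (k ℕ.+ a) ⊖ (k ℕ.+ b) ≈ a ⊖ b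
  ⊖-shift k a b = begin
    (k ℕ.+ a) ⊖ (k ℕ.+ b) ≈⟨ ⊖-+ k k a b ⟩
    k ⊖ k + a ⊖ b         ≈⟨ +-congʳ (-‿inverseʳ (embed k)) ⟩
    0# + a ⊖ b            ≈⟨ +-identityˡ (a ⊖ b) ⟩
    a ⊖ b                 ∎

  ⟦⟧ᶜ≈⊖ : ∀ a b → ⟦ a , b ⟧ᶜ ≈ a ⊖ b
  ⟦⟧ᶜ≈⊖ a       zero    = sym (trans (+-congˡ -0#≈0#) (+-identityʳ (embed a)))
  ⟦⟧ᶜ≈⊖ zero    (suc b) = sym (+-identityˡ (- embed (suc b)))
  ⟦⟧ᶜ≈⊖ (suc a) (suc b) = trans (⟦⟧ᶜ≈⊖ a b) (sym (⊖-shift 1 a b))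

  ⟦⟧ᶜ-+ : ∀ p q → ⟦ RawRing._+_ differences p q ⟧ᶜ ≈ ⟦ p ⟧ᶜ + ⟦ q ⟧ᶜ
  ⟦⟧ᶜ-+ (a , b) (c , d) = begin
    ⟦ a ℕ.+ c , b ℕ.+ d ⟧ᶜ ≈⟨ ⟦⟧ᶜ≈⊖ (a ℕ.+ c) (b ℕ.+ d) ⟩
    (a ℕ.+ c) ⊖ (b ℕ.+ d)  ≈⟨ ⊖-+ a b c d ⟩
    a ⊖ b + c ⊖ d          ≈⟨ +-cong (⟦⟧ᶜ≈⊖ a b) (⟦⟧ᶜ≈⊖ c d) ⟨
    ⟦ a , b ⟧ᶜ + ⟦ c , d ⟧ᶜ ∎

  ⟦⟧ᶜ-* : ∀ p q → ⟦ RawRing._*_ differences p q ⟧ᶜ ≈ ⟦ p ⟧ᶜ * ⟦ q ⟧ᶜ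
  ⟦⟧ᶜ-* (a , b) (c , d) = begin
    ⟦ a ℕ.* c ℕ.+ b ℕ.* d , a ℕ.* d ℕ.+ b ℕ.* c ⟧ᶜ
      ≈⟨ ⟦⟧ᶜ≈⊖ (a ℕ.* c ℕ.+ b ℕ.* d) (a ℕ.* d ℕ.+ b ℕ.* c) ⟩
    (a ℕ.* c ℕ.+ b ℕ.* d) ⊖ (a ℕ.* d ℕ.+ b ℕ.* c)
      ≈⟨ ⊖-* a b c d ⟩
    (a ⊖ b) * (c ⊖ d)
      ≈⟨ *-cong (⟦⟧ᶜ≈⊖ a b) (⟦⟧ᶜ≈⊖ c d) ⟨
    ⟦ a , b ⟧ᶜ * ⟦ c , d ⟧ᶜ ∎

  ⟦⟧ᶜ-neg : ∀ p → ⟦ RawRing.-_ differences p ⟧ᶜ ≈ - ⟦ p ⟧ᶜ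
  ⟦⟧ᶜ-neg (a , b) = begin
    ⟦ b , a ⟧ᶜ  ≈⟨ ⟦⟧ᶜ≈⊖ b a ⟩
    b ⊖ a       ≈⟨ ⁻¹-anti-homo‿- (embed a) (embed b) ⟨
    - (a ⊖ b)   ≈⟨ -‿cong (⟦⟧ᶜ≈⊖ a b) ⟨
    - ⟦ a , b ⟧ᶜ ∎

  embedding : differences -Raw-AlmostCommutative⟶ fromCommutativeRing R
  embedding = record
    { ⟦_⟧    = ⟦_⟧ᶜ
    ; +-homo = ⟦⟧ᶜ-+
    ; *-homo = ⟦⟧ᶜ-*
    ; -‿homo = ⟦⟧ᶜ-neg
    ; 0-homo = refl
    ; 1-homo = refl
    }

  ⟦⟧ᶜ-≈? : ∀ p q → Maybe (⟦ p ⟧ᶜ ≈ ⟦ q ⟧ᶜ)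
  ⟦⟧ᶜ-≈? (a , b) (c , d) with a ℕ.+ d ℕ.≟ c ℕ.+ b
  ... | no _        = nothing
  ... | yes a+d≡c+b = just (begin
    ⟦ a , b ⟧ᶜ            ≈⟨ ⟦⟧ᶜ≈⊖ a b ⟩
    a ⊖ b                 ≈⟨ ⊖-shift d a b ⟨
    (d ℕ.+ a) ⊖ (d ℕ.+ b) ≡⟨ ≡.cong₂ _⊖_ d+a≡b+c (ℕ.+-comm d b) ⟩
    (b ℕ.+ c) ⊖ (b ℕ.+ d) ≈⟨ ⊖-shift b c d ⟩
    c ⊖ d                 ≈⟨ ⟦⟧ᶜ≈⊖ c d ⟨
    ⟦ c , d ⟧ᶜ            ∎)
    where
    d+a≡b+c : d ℕ.+ a ≡ b ℕ.+ c
    d+a≡b+c = ≡.trans (ℕ.+-comm d a) (≡.trans a+d≡c+b (ℕ.+-comm c b))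

  open import Algebra.Solver.Ring differences (fromCommutativeRing R) embedding ⟦⟧ᶜ-≈? public

  :0 :1 : ∀ {n} → Polynomial n
  :0 = con (0 , 0)
  :1 = con (1 , 0)

module FieldLemmas {ℓ₁ ℓ₂} (K : FiniteField ℓ₁ ℓ₂) where
  open FiniteField K
  open import Algebra.Properties.Ring ring using (x∙y⁻¹≈ε⇒x≈y; +-inverseˡ-unique)
  open DifferenceCoefficientSolver commRing
  open import Relation.Binary.Reasoning.Setoid setoid

  x*y≈0⇒x≈0⊎y≈0 : ∀ {u v} → u * v ≈ 0# → u ≈ 0# ⊎ v ≈ 0#
  x*y≈0⇒x≈0⊎y≈0 {u} {v} uv≈0 with u ≟ 0#
  ... | yes u≈0 = inj₁ u≈0
  ... | no u≉0 with inverse u u≉0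
  ...   | w , uw≈1 = inj₂ (begin
    v           ≈⟨ *-identityˡ v ⟨
    1# * v      ≈⟨ *-congʳ uw≈1 ⟨
    (u * w) * v ≈⟨ solve 3 (λ u w v → (u :* w) :* v := w :* (u :* v)) refl u w v ⟩
    w * (u * v) ≈⟨ *-congˡ uv≈0 ⟩
    w * 0#      ≈⟨ zeroʳ w ⟩
    0#          ∎)

  x*x≈0⇒x≈0 : ∀ {u} → u * u ≈ 0# → u ≈ 0#
  x*x≈0⇒x≈0 uu≈0 = Sum.reduce (x*y≈0⇒x≈0⊎y≈0 uu≈0)

  x*x≈1⇒x≈±1 : ∀ {u} → u * u ≈ 1# → u ≈ 1# ⊎ u ≈ - 1#
  x*x≈1⇒x≈±1 {u} uu≈1 =
    Sum.map (x∙y⁻¹≈ε⇒x≈y u 1#) (+-inverseˡ-unique u 1#) (x*y≈0⇒x≈0⊎y≈0 (begin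
      (u - 1#) * (u + 1#) ≈⟨ solve 1 (λ u → (u :- :1) :* (u :+ :1) := u :* u :- :1) refl u ⟩
      u * u - 1#          ≈⟨ +-congʳ uu≈1 ⟩
      1# - 1#             ≈⟨ -‿inverseʳ 1# ⟩
      0#                  ∎))

module Matrices {ℓ₁ ℓ₂} (K : FiniteField ℓ₁ ℓ₂) where
  open FiniteField K
  open DifferenceCoefficientSolver commRing
  open import Relation.Binary.Reasoning.Setoid setoid

  infixl 7 _⊙_
  infix 4 _≃_ _≈±Id

  _⊙_ : Mat K → Mat K → Mat K
  _⊙_ = _·_ K

  _≃_ : Mat K → Mat K → Set ℓ₂
  _≃_ = _≈M_ K

  _≈±Id : Mat K → Set ℓ₂
  A ≈±Id = A ≃ Id K ⊎ A ≃ -Id K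

  ≃-refl : ∀ {A} → A ≃ A
  ≃-refl = refl , refl , refl , refl

  ≃-sym : ∀ {A B} → A ≃ B → B ≃ A
  ≃-sym (p , q , r , s) = sym p , sym q , sym r , sym s

  ≃-trans : ∀ {A B C} → A ≃ B → B ≃ C → A ≃ C
  ≃-trans (p , q , r , s) (p′ , q′ , r′ , s′) =
    trans p p′ , trans q q′ , trans r r′ , trans s s′

  ⊙-cong : ∀ {A A′ B B′} → A ≃ A′ → B ≃ B′ → A ⊙ B ≃ A′ ⊙ B′
  ⊙-cong (p , q , r , s) (p′ , q′ , r′ , s′) =
    +-cong (*-cong p p′) (*-cong q r′) , +-cong (*-cong p q′) (*-cong q s′) ,
    +-cong (*-cong r p′) (*-cong s r′) , +-cong (*-cong r q′) (*-cong s s′)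

  ⊙-assoc : ∀ A B C → (A ⊙ B) ⊙ C ≃ A ⊙ (B ⊙ C)
  ⊙-assoc (mat a b c d) (mat e f g h) (mat i j k l) =
    entry a b e f g h i k , entry a b e f g h j l , entry c d e f g h i k , entry c d e f g h j l
    where
    entry : ∀ p q e f g h r s →
            (p * e + q * g) * r + (p * f + q * h) * s ≈ p * (e * r + f * s) + q * (g * r + h * s)
    entry = solve 8 (λ p q e f g h r s →
                       (p :* e :+ q :* g) :* r :+ (p :* f :+ q :* h) :* s
                       := p :* (e :* r :+ f :* s) :+ q :* (g :* r :+ h :* s))
                    refl

  ⊙-identityˡ : ∀ A → Id K ⊙ A ≃ A
  ⊙-identityˡ (mat a b c d) = first a c , first b d , second a c , second b d
    where
    first  : ∀ u v → 1# * u + 0# * v ≈ u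
    second : ∀ u v → 0# * u + 1# * v ≈ v
    first  = solve 2 (λ u v → :1 :* u :+ :0 :* v := u) refl
    second = solve 2 (λ u v → :0 :* u :+ :1 :* v := v) refl

  ⊙-identityʳ : ∀ A → A ⊙ Id K ≃ A
  ⊙-identityʳ (mat a b c d) = first a b , second a b , first c d , second c d
    where
    first  : ∀ u v → u * 1# + v * 0# ≈ u
    second : ∀ u v → u * 0# + v * 1# ≈ v
    first  = solve 2 (λ u v → u :* :1 :+ v :* :0 := u) refl
    second = solve 2 (λ u v → u :* :0 :+ v :* :1 := v) refl

  -Id⊙-Id : -Id K ⊙ -Id K ≃ Id K
  -Id⊙-Id = solve 0 (:- :1 :* :- :1 :+ :0 :* :0 := :1) refl
          , solve 0 (:- :1 :* :0 :+ :0 :* :- :1 := :0) refl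
          , solve 0 (:0 :* :- :1 :+ :- :1 :* :0 := :0) refl
          , solve 0 (:0 :* :0 :+ :- :1 :* :- :1 := :1) refl

  M-++ : ∀ as bs → M K (as ++ bs) ≃ M K bs ⊙ M K as
  M-++ []       bs = ≃-sym (⊙-identityʳ (M K bs))
  M-++ (a ∷ as) bs =
    ≃-trans (⊙-cong (M-++ as bs) ≃-refl) (⊙-assoc (M K bs) (M K as) (elemM K a))

  ≈±Id-respˡ : ∀ {A B} → A ≃ B → B ≈±Id → A ≈±Id
  ≈±Id-respˡ A≃B = Sum.map (≃-trans A≃B) (≃-trans A≃B)

  ⊙-≈±Id : ∀ {A B} → A ≈±Id → B ≈±Id → A ⊙ B ≈±Id
  ⊙-≈±Id (inj₁ A≃I)  (inj₁ B≃I)  = inj₁ (≃-trans (⊙-cong A≃I B≃I) (⊙-identityˡ (Id K)))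
  ⊙-≈±Id (inj₁ A≃I)  (inj₂ B≃-I) = inj₂ (≃-trans (⊙-cong A≃I B≃-I) (⊙-identityˡ (-Id K)))
  ⊙-≈±Id (inj₂ A≃-I) (inj₁ B≃I)  = inj₂ (≃-trans (⊙-cong A≃-I B≃I) (⊙-identityʳ (-Id K)))
  ⊙-≈±Id (inj₂ A≃-I) (inj₂ B≃-I) = inj₁ (≃-trans (⊙-cong A≃-I B≃-I) -Id⊙-Id)

  ≈±Id⇒offDiagonal≈0 : ∀ {A} → A ≈±Id → Mat.m12 A ≈ 0# × Mat.m21 A ≈ 0#
  ≈±Id⇒offDiagonal≈0 (inj₁ (_ , p , q , _)) = p , q
  ≈±Id⇒offDiagonal≈0 (inj₂ (_ , p , q , _)) = p , q

  scalar-≈±Id : ∀ {d} → d ≈ 1# ⊎ d ≈ - 1# → mat d 0# 0# d ≈±Id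
  scalar-≈±Id (inj₁ d≈1)  = inj₁ (d≈1 , refl , refl , d≈1)
  scalar-≈±Id (inj₂ d≈-1) = inj₂ (d≈-1 , refl , refl , d≈-1)

  det : Mat K → Carrier
  det (mat a b c d) = a * d - b * c

  det-cong : ∀ {A B} → A ≃ B → det A ≈ det B
  det-cong (p , q , r , s) = +-cong (*-cong p s) (-‿cong (*-cong q r))

  det-⊙ : ∀ A B → det (A ⊙ B) ≈ det A * det B
  det-⊙ (mat a b c d) (mat e f g h) =
    solve 8 (λ a b c d e f g h →
               (a :* e :+ b :* g) :* (c :* f :+ d :* h) :- (a :* f :+ b :* h) :* (c :* e :+ d :* g)
               := (a :* d :- b :* c) :* (e :* h :- f :* g))
            refl a b c d e f g h

  det-M : ∀ as → det (M K as) ≈ 1#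
  det-M []       = solve 0 (:1 :* :1 :- :0 :* :0 := :1) refl
  det-M (a ∷ as) = begin
    det (M K as ⊙ elemM K a)       ≈⟨ det-⊙ (M K as) (elemM K a) ⟩
    det (M K as) * det (elemM K a) ≈⟨ *-cong (det-M as) det-elemM ⟩
    1# * 1#                        ≈⟨ *-identityˡ 1# ⟩
    1#                             ∎
    where
    det-elemM : det (elemM K a) ≈ 1#
    det-elemM = solve 1 (λ a → a :* :0 :- :- :1 :* :1 := :1) refl a

module Powers {ℓ₁ ℓ₂} (K : FiniteField ℓ₁ ℓ₂) where
  open FiniteField K
  open import Algebra.Properties.Ring ring using (-‿injective; -0#≈0#)
  open DifferenceCoefficientSolver commRing
  open FieldLemmas K
  open Matrices K
  open import Relation.Binary.Reasoning.Setoid setoid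

  -- powerForm y c d = d·Id + c·E(y), where E(y) = elemM K y.
  powerForm : Carrier → Carrier → Carrier → Mat K
  powerForm y c d = mat (d + y * c) (- c) c d

  eCoeff idCoeff : Carrier → ℕ → Carrier
  eCoeff  y zero    = 0#
  eCoeff  y (suc k) = eCoeff y k * y + idCoeff y k
  idCoeff y zero    = 1#
  idCoeff y (suc k) = - eCoeff y k

  powerForm-cong : ∀ {y c c′ d d′} → c ≈ c′ → d ≈ d′ → powerForm y c d ≃ powerForm y c′ d′
  powerForm-cong c≈c′ d≈d′ = +-cong d≈d′ (*-congˡ c≈c′) , -‿cong c≈c′ , c≈c′ , d≈d′

  powerForm-step : ∀ y c d → powerForm y c d ⊙ elemM K y ≃ powerForm y (c * y + d) (- c)
  powerForm-step y c d =
      solve 3 (λ y c d → (d :+ y :* c) :* y :+ :- c :* :1 := :- c :+ y :* (c :* y :+ d)) refl y c d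
    , solve 3 (λ y c d → (d :+ y :* c) :* :- :1 :+ :- c :* :0 := :- (c :* y :+ d)) refl y c d
    , solve 3 (λ y c d → c :* y :+ d :* :1 := c :* y :+ d) refl y c d
    , solve 3 (λ y c d → c :* :- :1 :+ d :* :0 := :- c) refl y c d

  M-replicate : ∀ y k → M K (replicate k y) ≃ powerForm y (eCoeff y k) (idCoeff y k)
  M-replicate y zero    = solve 1 (λ y → :1 := :1 :+ y :* :0) refl y
                        , solve 0 (:0 := :- :0) refl
                        , refl , refl
  M-replicate y (suc k) = ≃-trans (⊙-cong (M-replicate y k) ≃-refl) (powerForm-step y _ _)

  powerForm-≈±Id : ∀ {y c d} → c ≈ 0# → det (powerForm y c d) ≈ 1# → powerForm y c d ≈±Id
  powerForm-≈±Id {y} {c} {d} c≈0 det≈1 =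
    ≈±Id-respˡ (≃-trans (powerForm-cong c≈0 refl) diagonal) (scalar-≈±Id (x*x≈1⇒x≈±1 d*d≈1))
    where
    diagonal : powerForm y 0# d ≃ mat d 0# 0# d
    diagonal = solve 2 (λ y d → d :+ y :* :0 := d) refl y d , -0#≈0# , refl , refl
    d*d≈1 : d * d ≈ 1#
    d*d≈1 = begin
      d * d                  ≈⟨ solve 2 (λ y d → d :* d := (d :+ y :* :0) :* d :- :- :0 :* :0)
                                        refl y d ⟩
      det (powerForm y 0# d) ≈⟨ det-cong (powerForm-cong c≈0 refl) ⟨
      det (powerForm y c d)  ≈⟨ det≈1 ⟩
      1#                     ∎

  M-replicate-≈±Id⇔ : ∀ y k → M K (replicate k y) ≈±Id ⇔ eCoeff y k ≈ 0#
  M-replicate-≈±Id⇔ y k = mk⇔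
    (λ M≈±Id → trans (sym m21≈c) (proj₂ (≈±Id⇒offDiagonal≈0 M≈±Id)))
    (λ c≈0 → ≈±Id-respˡ M≃P
               (powerForm-≈±Id c≈0 (trans (sym (det-cong M≃P)) (det-M (replicate k y)))))
    where
    M≃P : M K (replicate k y) ≃ powerForm y (eCoeff y k) (idCoeff y k)
    M≃P = M-replicate y k
    m21≈c : Mat.m21 (M K (replicate k y)) ≈ eCoeff y k
    m21≈c = proj₁ (proj₂ (proj₂ M≃P))

  eCoeff-1 : ∀ y → eCoeff y 1 ≈ 1#
  eCoeff-1 = solve 1 (λ y → :0 :* y :+ :1 := :1) refl

  eCoeff-2 : ∀ y → eCoeff y 2 ≈ y
  eCoeff-2 = solve 1 (λ y → (:0 :* y :+ :1) :* y :+ :- :0 := y) refl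

  sign : ℕ → Carrier
  sign zero    = 1#
  sign (suc k) = - sign k

  sign-square : ∀ k → sign k * sign k ≈ 1#
  sign-square zero    = *-identityˡ 1#
  sign-square (suc k) = trans (solve 1 (λ s → :- s :* :- s := s :* s) refl (sign k)) (sign-square k)

  sign≉0 : ∀ k → ¬ sign k ≈ 0#
  sign≉0 k s≈0 = 1≉0 (trans (sym (sign-square k)) (trans (*-congʳ s≈0) (zeroˡ (sign k))))

  coeffs-neg : ∀ y k → eCoeff (- y) k ≈ - (sign k * eCoeff y k)
                     × idCoeff (- y) k ≈ sign k * idCoeff y k
  coeffs-neg y zero    = solve 0 (:0 := :- (:1 :* :0)) refl , sym (*-identityˡ 1#)
  coeffs-neg y (suc k) = eCoeff-step , idCoeff-step
    where
    s c d : Carrier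
    s = sign k
    c = eCoeff y k
    d = idCoeff y k
    eCoeff-step : eCoeff (- y) k * - y + idCoeff (- y) k ≈ - (- s * (c * y + d))
    eCoeff-step = begin
      eCoeff (- y) k * - y + idCoeff (- y) k
        ≈⟨ +-cong (*-congʳ (proj₁ (coeffs-neg y k))) (proj₂ (coeffs-neg y k)) ⟩
      - (s * c) * - y + s * d
        ≈⟨ solve 4 (λ y s c d → :- (s :* c) :* :- y :+ s :* d := :- (:- s :* (c :* y :+ d)))
                 refl y s c d ⟩
      - (- s * (c * y + d)) ∎
    idCoeff-step : - eCoeff (- y) k ≈ - s * - c
    idCoeff-step = begin
      - eCoeff (- y) k ≈⟨ -‿cong (proj₁ (coeffs-neg y k)) ⟩
      - - (s * c)      ≈⟨ solve 2 (λ s c → :- :- (s :* c) := :- s :* :- c) refl s c ⟩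
      - s * - c        ∎

  M-polarized : ∀ y k → M K (polarized K k y) ≃
    powerForm (- y) (- (sign k * eCoeff y k)) (sign k * idCoeff y k)
      ⊙ powerForm y (eCoeff y k) (idCoeff y k)
  M-polarized y k =
    ≃-trans (M-++ (replicate k y) (replicate k (- y))) (⊙-cong M₋≃P₋ (M-replicate y k))
    where
    M₋≃P₋ : M K (replicate k (- y)) ≃
            powerForm (- y) (- (sign k * eCoeff y k)) (sign k * idCoeff y k)
    M₋≃P₋ = ≃-trans (M-replicate (- y) k)
                    (powerForm-cong (proj₁ (coeffs-neg y k)) (proj₂ (coeffs-neg y k)))

  polarizedProduct-m12 : ∀ y s c d →
    Mat.m12 (powerForm (- y) (- (s * c)) (s * d) ⊙ powerForm y c d) ≈ - (s * (y * (c * c)))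
  polarizedProduct-m12 = solve 4 (λ y s c d →
    (s :* d :+ :- y :* :- (s :* c)) :* :- c :+ :- :- (s :* c) :* d
    := :- (s :* (y :* (c :* c)))) refl

  M-polarized-m12 : ∀ y k →
    Mat.m12 (M K (polarized K k y)) ≈ - (sign k * (y * (eCoeff y k * eCoeff y k)))
  M-polarized-m12 y k =
    trans (proj₁ (proj₂ (M-polarized y k)))
          (polarizedProduct-m12 y (sign k) (eCoeff y k) (idCoeff y k))

  M-polarized-≈±Id⇔ : ∀ {y} → ¬ y ≈ 0# → ∀ k → M K (polarized K k y) ≈±Id ⇔ eCoeff y k ≈ 0#
  M-polarized-≈±Id⇔ {y} y≉0 k = mk⇔ ≈±Id⇒c≈0 c≈0⇒≈±Id
    where
    s c : Carrier
    s = sign k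
    c = eCoeff y k
    ≈±Id⇒c≈0 : M K (polarized K k y) ≈±Id → c ≈ 0#
    ≈±Id⇒c≈0 M≈±Id with x*y≈0⇒x≈0⊎y≈0 (-‿injective (begin
        - (s * (y * (c * c)))           ≈⟨ M-polarized-m12 y k ⟨
        Mat.m12 (M K (polarized K k y)) ≈⟨ proj₁ (≈±Id⇒offDiagonal≈0 M≈±Id) ⟩
        0#                              ≈⟨ -0#≈0# ⟨
        - 0#                            ∎))
    ... | inj₁ s≈0   = ⊥-elim (sign≉0 k s≈0)
    ... | inj₂ ycc≈0 = Sum.[ ⊥-elim ∘ y≉0 , x*x≈0⇒x≈0 ]′ (x*y≈0⇒x≈0⊎y≈0 ycc≈0)
    c≈0⇒≈±Id : c ≈ 0# → M K (polarized K k y) ≈±Id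
    c≈0⇒≈±Id c≈0 = ≈±Id-respˡ (M-++ (replicate k y) (replicate k (- y)))
      (⊙-≈±Id (from (M-replicate-≈±Id⇔ (- y) k) c₋≈0) (from (M-replicate-≈±Id⇔ y k) c≈0))
      where
      c₋≈0 : eCoeff (- y) k ≈ 0#
      c₋≈0 = begin
        eCoeff (- y) k ≈⟨ proj₁ (coeffs-neg y k) ⟩
        - (s * c)      ≈⟨ -‿cong (*-congˡ c≈0) ⟩
        - (s * 0#)     ≈⟨ -‿cong (zeroʳ s) ⟩
        - 0#           ≈⟨ -0#≈0# ⟩
        0#             ∎

  polarized-solution⇔monomial-solution : ∀ {y} → ¬ y ≈ 0# → ∀ k →
    IsSolution K (polarized K k y) ⇔ IsSolution K (monomial K k y)
  polarized-solution⇔monomial-solution y≉0 zero = mk⇔ (λ { (() , _) }) (λ { (() , _) })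
  polarized-solution⇔monomial-solution {y} y≉0 k@(suc _) = mk⇔
    (λ (_ , P≈±Id) → s≤s z≤n , from (M-replicate-≈±Id⇔ y k) (to (M-polarized-≈±Id⇔ y≉0 k) P≈±Id))
    (λ (_ , M≈±Id) → s≤s z≤n , from (M-polarized-≈±Id⇔ y≉0 k) (to (M-replicate-≈±Id⇔ y k) M≈±Id))

  monomial-solution⇒3≤size : ∀ {y n} → ¬ y ≈ 0# → IsSolution K (monomial K n y) → 3 ≤ n
  monomial-solution⇒3≤size {n = 0} _ (() , _)
  monomial-solution⇒3≤size {y} {1} _ (_ , M≈±Id) =
    ⊥-elim (1≉0 (trans (sym (eCoeff-1 y)) (to (M-replicate-≈±Id⇔ y 1) M≈±Id)))
  monomial-solution⇒3≤size {y} {2} y≉0 (_ , M≈±Id) =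
    ⊥-elim (y≉0 (trans (sym (eCoeff-2 y)) (to (M-replicate-≈±Id⇔ y 2) M≈±Id)))
  monomial-solution⇒3≤size {n = suc (suc (suc _))} _ _ = s≤s (s≤s (s≤s z≤n))

module _ {a} {A : Set a} where

  drop-replicate-++ : ∀ n (y : A) zs → drop n (replicate (suc n) y ++ zs) ≡ y ∷ zs
  drop-replicate-++ zero    y zs = ≡.refl
  drop-replicate-++ (suc n) y zs = drop-replicate-++ n y zs

  take-replicate-++ : ∀ n (y : A) zs → take n (replicate (suc n) y ++ zs) ≡ replicate n y
  take-replicate-++ zero    y zs = ≡.refl
  take-replicate-++ (suc n) y zs = ≡.cong (y ∷_) (take-replicate-++ n y zs)

  replicate-suc-∷ʳ : ∀ n (y : A) → replicate (suc n) y ≡ replicate n y ∷ʳ y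
  replicate-suc-∷ʳ zero    y = ≡.refl
  replicate-suc-∷ʳ (suc n) y = ≡.cong (y ∷_) (replicate-suc-∷ʳ n y)

module Tuples {ℓ₁ ℓ₂} (K : FiniteField ℓ₁ ℓ₂) where
  open FiniteField K

  dropLast-∷ʳ : ∀ xs z → dropLast K (xs ∷ʳ z) ≡ xs
  dropLast-∷ʳ []           z = ≡.refl
  dropLast-∷ʳ (x ∷ [])     z = ≡.refl
  dropLast-∷ʳ (x ∷ y ∷ xs) z = ≡.cong (x ∷_) (dropLast-∷ʳ (y ∷ xs) z)

  lastOf-∷ʳ : ∀ y xs z → lastOf K y (xs ∷ʳ z) ≡ z
  lastOf-∷ʳ y []       z = ≡.refl
  lastOf-∷ʳ y (x ∷ xs) z = lastOf-∷ʳ x xs z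

  ⊕-∷ʳ : ∀ a xs b y ys z →
    _⊕_ K (a ∷ (xs ∷ʳ b)) (y ∷ (ys ∷ʳ z)) ≡ (a + z) ∷ xs ++ (b + y) ∷ ys
  ⊕-∷ʳ a xs b y ys z =
    ≡.cong₂ (λ u vs → (a + u) ∷ vs) (lastOf-∷ʳ y ys z)
            (≡.cong₂ _++_ (dropLast-∷ʳ xs b)
                          (≡.cong₂ (λ u vs → (u + y) ∷ vs) (lastOf-∷ʳ a xs b) (dropLast-∷ʳ ys z)))

  -- The witness: (y, …, y, −y, …, −y) rotated by m − 1 is (0, −y, …, −y, 0) ⊕ (y, …, y).
  polarized-reducible : ∀ {m y} → 3 ≤ m → IsSolution K (monomial K m y) →
                        Reducible K (polarized K m y)
  polarized-reducible {m@(suc (suc (suc n)))} {y} (s≤s (s≤s (s≤s z≤n))) solution =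
    s≤s (s≤s (s≤s z≤n)) , 0# ∷ (negated ∷ʳ 0#) , monomial K m y ,
    s≤s (s≤s (s≤s z≤n)) , s≤s (s≤s (s≤s z≤n)) , solution ,
    suc (suc n) , shift≤length , inj₁ (≡.subst₂ (_≋_ K) (≡.sym ⊕≡) (≡.sym rotate≡) pointwise)
    where
    negated tail : List Carrier
    negated = replicate m (- y)
    tail    = replicate (suc n) y
    shift≤length : suc (suc n) ≤ length (polarized K m y)
    shift≤length = ℕ.≤-trans (ℕ.n≤1+n (suc (suc n)))
      (≡.subst (_≤ length (polarized K m y)) (length-replicate m) (length-++-≤ˡ (replicate m y)))
    ⊕≡ : _⊕_ K (0# ∷ (negated ∷ʳ 0#)) (monomial K m y) ≡ (0# + y) ∷ negated ++ (0# + y) ∷ tail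
    ⊕≡ = ≡.trans (≡.cong (λ ys → _⊕_ K (0# ∷ (negated ∷ʳ 0#)) (y ∷ ys))
                         (replicate-suc-∷ʳ (suc n) y))
                 (⊕-∷ʳ 0# negated 0# y tail y)
    rotate≡ : rotate K (suc (suc n)) (polarized K m y) ≡ y ∷ negated ++ y ∷ tail
    rotate≡ = ≡.cong₂ _++_ (drop-replicate-++ (suc (suc n)) y negated)
                           (take-replicate-++ (suc (suc n)) y negated)
    pointwise : _≋_ K ((0# + y) ∷ negated ++ (0# + y) ∷ tail) (y ∷ negated ++ y ∷ tail)
    pointwise = +-identityˡ y ∷ Pointwise.++⁺ (Pointwise.refl refl {negated})
                                               (+-identityˡ y ∷ Pointwise.refl refl)

proposition7p8 : ∀ {c ℓ} (K : FiniteField c ℓ) → CharNot2 K →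
    (x : FiniteField.Carrier K) → ¬ (FiniteField._≈_ K x (FiniteField.0# K)) →
    (m : ℕ) → IsMonomialMinimalSize K x m →
    IsPolarizedMinimalHalf K x m × Reducible K (polarized K m x)
proposition7p8 K _ x x≉0 m (solution , minimal) =
  (1≤m , from (polarized-solution⇔monomial-solution x≉0 m) solution , polarizedMinimal) ,
  polarized-reducible 3≤m solution
  where
  open Powers K
  open Tuples K
  3≤m : 3 ≤ m
  3≤m = monomial-solution⇒3≤size x≉0 solution
  1≤m : 1 ≤ m
  1≤m = ℕ.≤-trans (s≤s z≤n) 3≤m
  polarizedMinimal : ∀ k → 1 ≤ k → k < m → ¬ IsSolution K (polarized K k x)
  polarizedMinimal k 1≤k k<m =
    minimal k 1≤k k<m ∘ to (polarized-solution⇔monomial-solution x≉0 k)
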